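{- Let $k,\ell\ge0$, let $T$ be a set of $t$ positive integers (car labels), and let $\pi=\pi_0\pi_1\cdots\pi_t$ with $\pi_0=0$ and $\pi_1\cdots\pi_t$ a permutation of $T$. For $1\le v\le t$, consider a street with spots $0,1,\dots,t$ in which spot $0$ is empty and, for $u\ge1$, spot $u$ is occupied exactly when $\pi_u<\pi_v$. Let $\mathrm{B}(\pi_v)$ (resp. $\mathrm{F}(\pi_v)$) be the number of preferences $a\in[t]$ such that a car with preference $a$ finds spot $a$ occupied and, under the $(k,\ell)$-pullback rule on this street, backs into spot $v$ (resp. fails to park while backing up and then moves forward into spot $v$). Then $\mathrm{B}(\pi_v)=\min(\mathrm{Right}(\pi_v),k)$ and $\mathrm{F}(\pi_v)=\max(\min(\mathrm{Left}(\pi_v)-k,\ell),0)$.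
   Context: $(k,\ell)$-pullback parking rule: a car with preference $a$ parks in spot $a$ if it is empty; otherwise it checks spots $a-1,\dots,a-k$ in order (not below the first spot of the street, here spot $0$) and parks in the first empty one; if none, it checks spots $a+1,\dots,a+\ell$ in order (not beyond the last spot) and parks in the first empty one; otherwise it fails. $\mathrm{Right}(\pi_v)$ is the largest $x\ge0$ with $\pi_y<\pi_v$ for all $v+1\le y\le v+x\le t$; $\mathrm{Left}(\pi_v)$ is the largest $x\ge0$ with $0<\pi_z<\pi_v$ for all $1\le v-x\le z\le v-1$. -}

module Defs where

open import Data.Nat using (ℕ; zero; suc; _+_; _∸_; _≤_; _<_; _<ᵇ_; _⊓_; _≡ᵇ_)
open import Data.Bool using (Bool; true; false; not; _∧_)
open import Data.Maybe using (Maybe; just; nothing)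
open import Data.List using (List; []; _∷_; map; applyUpTo; filterᵇ; length)
open import Data.Product using (_×_)

occ : (ℕ → ℕ) → ℕ → ℕ → Bool
occ π v zero    = false
occ π v (suc u) = π (suc u) <ᵇ π v

firstFree : (ℕ → Bool) → List ℕ → Maybe ℕ
firstFree o []       = nothing
firstFree o (s ∷ ss) with o s
... | true  = firstFree o ss
... | false = just s

backSpots : ℕ → ℕ → List ℕ
backSpots k a = map (a ∸_) (applyUpTo suc (k ⊓ a))

fwdSpots : ℕ → ℕ → ℕ → List ℕ
fwdSpots t ℓ a = map (a +_) (applyUpTo suc (ℓ ⊓ (t ∸ a)))

isJust≡ : Maybe ℕ → ℕ → Bool
isJust≡ (just s) v = s ≡ᵇ v
isJust≡ nothing  v = false

isNothing : Maybe ℕ → Bool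
isNothing nothing  = true
isNothing (just _) = false

prefs : ℕ → List ℕ
prefs t = applyUpTo suc t

Bcount : (k t : ℕ) (π : ℕ → ℕ) (v : ℕ) → ℕ
Bcount k t π v = length (filterᵇ
  (λ a → occ π v a ∧ isJust≡ (firstFree (occ π v) (backSpots k a)) v)
  (prefs t))

Fcount : (k ℓ t : ℕ) (π : ℕ → ℕ) (v : ℕ) → ℕ
Fcount k ℓ t π v = length (filterᵇ
  (λ a → occ π v a ∧ isNothing (firstFree (occ π v) (backSpots k a))
                   ∧ isJust≡ (firstFree (occ π v) (fwdSpots t ℓ a)) v)
  (prefs t))

RightOK : (t : ℕ) (π : ℕ → ℕ) (v x : ℕ) → Set
RightOK t π v x = (v + x ≤ t) × (∀ y → suc v ≤ y → y ≤ v + x → π y < π v)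

IsRight : (t : ℕ) (π : ℕ → ℕ) (v x : ℕ) → Set
IsRight t π v x = RightOK t π v x × (∀ x' → RightOK t π v x' → x' ≤ x)

LeftOK : (π : ℕ → ℕ) (v x : ℕ) → Set
LeftOK π v x = (x < v) × (∀ z → v ∸ x ≤ z → z ≤ v ∸ 1 → (0 < π z) × (π z < π v))

IsLeft : (π : ℕ → ℕ) (v x : ℕ) → Set
IsLeft π v x = LeftOK π v x × (∀ x' → LeftOK π v x' → x' ≤ x)

{-# OPTIONS --safe #-}
module Submission where

-- On the street of π_v, spots 0 and v are free and a spot u ≥ 1 is occupied iff π_u < π_v, so
-- Right and Left are the lengths of the maximal occupied runs just after and just before v.
-- A car preferring a backs into v iff a lies in the right run and a − v ≤ k, i.e. iff
-- v < a ≤ v + min(Right, k). It backs up in vain and then drives forward into v iff the spots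
-- a − k, …, v − 1 are all occupied (so a − k ≥ v − Left, as spot 0 is free) and v ≤ a + ℓ,
-- i.e. iff v − min(Left − k, ℓ) ≤ a < v. Both sets of preferences are intervals.

open import Data.Bool using (Bool; true; false; _∧_; T)
open import Data.Bool.Properties using (T-∧; T?)
open import Data.Integer using (+_; _-_; _⊔_) renaming (_⊓_ to _⊓ℤ_)
open import Data.Integer.Properties using ([+m]-[+n]≡m⊖n; ⊖-≥; ⊖-<)
open import Data.List using (List; _∷_; [_]; _++_; applyUpTo; filterᵇ; length)
open import Data.List.Properties
  using (applyUpTo-∷ʳ; map-applyUpTo; filter-++; filter-accept; filter-reject; length-++)
open import Data.Maybe using (just; nothing)
open import Data.Maybe.Properties using (just-injective)
open import Data.Nat using (ℕ; zero; suc; _+_; _∸_; _⊓_; _≤_; _<_; z≤n; s≤s; s≤s⁻¹; _≤?_; _<?_)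
open import Data.Nat.Properties
open import Data.Product using (_×_; _,_; proj₁; proj₂)
open import Data.Product.Function.NonDependent.Propositional using (_×-⇔_)
open import Data.Sum using (_⊎_; inj₁; inj₂)
open import Defs
open import Function using (_∘_)
open import Function.Bundles using (_⇔_; mk⇔; Equivalence)
open import Function.Construct.Composition using (_⇔-∘_)
open import Function.Construct.Identity using (⇔-id)
open import Relation.Binary.PropositionalEquality
  using (_≡_; _≗_; refl; sym; trans; cong; cong₂; subst; module ≡-Reasoning)
open import Relation.Nullary using (¬_; yes; no; contradiction)

open Equivalence using (to; from)

m∸n≤o⇒m≤n+o : ∀ m n {o} → m ∸ n ≤ o → m ≤ n + o
m∸n≤o⇒m≤n+o m n m∸n≤o = ≤-trans (m≤n+m∸n m n) (+-monoʳ-≤ n m∸n≤o)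

m∸n≤o⇒m∸o≤n : ∀ m n {o} → m ∸ n ≤ o → m ∸ o ≤ n
m∸n≤o⇒m∸o≤n m n {o} m∸n≤o = m≤n+o⇒m∸n≤o m o (subst (m ≤_) (+-comm n o) (m∸n≤o⇒m≤n+o m n m∸n≤o))

m∸[n⊓m]≡m∸n : ∀ m n → m ∸ (n ⊓ m) ≡ m ∸ n
m∸[n⊓m]≡m∸n m n with ≤-total n m
... | inj₁ n≤m = cong (m ∸_) (m≤n⇒m⊓n≡m n≤m)
... | inj₂ m≤n = trans (cong (m ∸_) (m≥n⇒m⊓n≡n m≤n)) (trans (n∸n≡0 m) (sym (m≤n⇒m∸n≡0 m≤n)))

m∸[[m∸n]+o]≡n∸o : ∀ {m n} o → n ≤ m → m ∸ ((m ∸ n) + o) ≡ n ∸ o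
m∸[[m∸n]+o]≡n∸o {m} {n} o n≤m = trans (sym (∸-+-assoc m (m ∸ n) o)) (cong (_∸ o) (m∸[m∸n]≡n n≤m))

+[m∸n⊓o]≡[+m-+n]⊓+o⊔0 : ∀ m n o → + ((m ∸ n) ⊓ o) ≡ ((+ m - + n) ⊓ℤ + o) ⊔ + 0
+[m∸n⊓o]≡[+m-+n]⊓+o⊔0 m n o rewrite [+m]-[+n]≡m⊖n m n with n ≤? m
... | yes n≤m rewrite ⊖-≥ n≤m = cong +_ (sym (⊔-identityʳ ((m ∸ n) ⊓ o)))
... | no n≰m rewrite ⊖-< (≰⇒> n≰m) | m≤n⇒m∸n≡0 (<⇒≤ (≰⇒> n≰m))
  with n ∸ m | m<n⇒0<n∸m (≰⇒> n≰m)
...   | suc _ | _ = refl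

applyUpTo-cong : ∀ {A : Set} {f g : ℕ → A} → f ≗ g → applyUpTo f ≗ applyUpTo g
applyUpTo-cong f≗g zero    = refl
applyUpTo-cong f≗g (suc n) = cong₂ _∷_ (f≗g 0) (applyUpTo-cong (f≗g ∘ suc) n)

spotsBelow : ℕ → ℕ → List ℕ
spotsBelow a n = applyUpTo (λ i → a ∸ suc i) n

spotsAbove : ℕ → ℕ → List ℕ
spotsAbove a n = applyUpTo (λ i → a + suc i) n

backSpots≡spotsBelow : ∀ k a → backSpots k a ≡ spotsBelow a (k ⊓ a)
backSpots≡spotsBelow k a = map-applyUpTo suc (a ∸_) (k ⊓ a)

fwdSpots≡spotsAbove : ∀ t ℓ a → fwdSpots t ℓ a ≡ spotsAbove a (ℓ ⊓ (t ∸ a))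
fwdSpots≡spotsAbove t ℓ a = map-applyUpTo suc (_+_ a) (ℓ ⊓ (t ∸ a))

spotsAbove-suc : ∀ a n → spotsAbove a (suc n) ≡ suc a ∷ spotsAbove (suc a) n
spotsAbove-suc a n = cong₂ _∷_ (+-comm a 1) (applyUpTo-cong (λ i → +-suc a (suc i)) n)

T-isJust≡ : ∀ r v → T (isJust≡ r v) ⇔ r ≡ just v
T-isJust≡ (just s) v = mk⇔ (cong just ∘ ≡ᵇ⇒≡ s v) (λ { refl → ≡⇒≡ᵇ s s refl })
T-isJust≡ nothing  v = mk⇔ (λ ()) (λ ())

T-isNothing : ∀ r → T (isNothing r) ⇔ r ≡ nothing
T-isNothing (just _) = mk⇔ (λ ()) (λ ())
T-isNothing nothing  = mk⇔ (λ _ → refl) (λ _ → _)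

Occupied : (ℕ → Bool) → ℕ → ℕ → Set
Occupied o i j = ∀ y → i ≤ y → y < j → T (o y)

module _ {o : ℕ → Bool} where

  Occupied-empty : ∀ {i j} → j ≤ i → Occupied o i j
  Occupied-empty j≤i y i≤y y<j = contradiction (≤-trans j≤i i≤y) (<⇒≱ y<j)

  Occupied-singleton : ∀ {i} → T (o i) → Occupied o i (suc i)
  Occupied-singleton oi y i≤y y<1+i with ≤-antisym i≤y (s≤s⁻¹ y<1+i)
  ... | refl = oi

  Occupied-join : ∀ {i j m} → Occupied o i j → Occupied o j m → Occupied o i m
  Occupied-join {j = j} occ₁ occ₂ y i≤y y<m with y <? j
  ... | yes y<j = occ₁ y i≤y y<j
  ... | no  y≮j = occ₂ y (≮⇒≥ y≮j) y<m

  Occupied-shrink : ∀ {i i′ j j′} → i ≤ i′ → j′ ≤ j → Occupied o i j → Occupied o i′ j′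
  Occupied-shrink i≤i′ j′≤j occ y i′≤y y<j′ = occ y (≤-trans i≤i′ i′≤y) (<-≤-trans y<j′ j′≤j)

  firstFree-free : ∀ {x xs} → ¬ T (o x) → firstFree o (x ∷ xs) ≡ just x
  firstFree-free {x} free with o x
  ... | true  = contradiction _ free
  ... | false = refl

  firstFree-occupied : ∀ {x xs} → T (o x) → firstFree o (x ∷ xs) ≡ firstFree o xs
  firstFree-occupied {x} ox with o x
  ... | true = refl

  firstFree-spotsBelow≡just : ∀ {a n s} → n ≤ a →
    firstFree o (spotsBelow a n) ≡ just s ⇔ (a ∸ n ≤ s × s < a × ¬ T (o s) × Occupied o (suc s) a)
  firstFree-spotsBelow≡just n≤a = mk⇔ (found n≤a) (find n≤a)
    where
    found : ∀ {a n s} → n ≤ a → firstFree o (spotsBelow a n) ≡ just s →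
            a ∸ n ≤ s × s < a × ¬ T (o s) × Occupied o (suc s) a
    found z≤n ()
    found {suc a} {suc n} (s≤s n≤a) ff with T? (o a)
    ... | yes oa =
      let a∸n≤s , s<a , free , run = found n≤a (trans (sym (firstFree-occupied {x = a} oa)) ff)
      in a∸n≤s , m<n⇒m<1+n s<a , free , Occupied-join run (Occupied-singleton oa)
    ... | no free with just-injective (trans (sym (firstFree-free {x = a} free)) ff)
    ...   | refl = m∸n≤m a n , ≤-refl , free , Occupied-empty ≤-refl

    find : ∀ {a n s} → n ≤ a → a ∸ n ≤ s × s < a × ¬ T (o s) × Occupied o (suc s) a →
           firstFree o (spotsBelow a n) ≡ just s
    find z≤n (a≤s , s<a , _) = contradiction a≤s (<⇒≱ s<a)
    find {suc a} (s≤s n≤a) (a∸n≤s , s<1+a , free , run) with m≤n⇒m<n∨m≡n (s≤s⁻¹ s<1+a)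
    ... | inj₂ refl = firstFree-free free
    ... | inj₁ s<a  = trans (firstFree-occupied (run a s<a ≤-refl))
                            (find n≤a (a∸n≤s , s<a , free , Occupied-shrink ≤-refl (n≤1+n a) run))

  firstFree-spotsBelow≡nothing : ∀ {a n} → n ≤ a →
    firstFree o (spotsBelow a n) ≡ nothing ⇔ Occupied o (a ∸ n) a
  firstFree-spotsBelow≡nothing n≤a = mk⇔ (allOccupied n≤a) (noneFree n≤a)
    where
    allOccupied : ∀ {a n} → n ≤ a → firstFree o (spotsBelow a n) ≡ nothing → Occupied o (a ∸ n) a
    allOccupied z≤n _ = Occupied-empty ≤-refl
    allOccupied {suc a} (s≤s n≤a) ff with T? (o a)
    ... | yes oa = Occupied-join (allOccupied n≤a (trans (sym (firstFree-occupied {x = a} oa)) ff))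
                                 (Occupied-singleton oa)
    ... | no free = contradiction (trans (sym (firstFree-free {x = a} free)) ff) λ ()

    noneFree : ∀ {a n} → n ≤ a → Occupied o (a ∸ n) a → firstFree o (spotsBelow a n) ≡ nothing
    noneFree z≤n _ = refl
    noneFree {suc a} {suc n} (s≤s n≤a) run =
      trans (firstFree-occupied (run a (m∸n≤m a n) ≤-refl))
            (noneFree n≤a (Occupied-shrink ≤-refl (n≤1+n a) run))

  firstFree-spotsAbove≡just : ∀ {a n s} →
    firstFree o (spotsAbove a n) ≡ just s ⇔ (a < s × s ≤ a + n × ¬ T (o s) × Occupied o (suc a) s)
  firstFree-spotsAbove≡just = mk⇔ found find
    where
    found : ∀ {a n s} → firstFree o (spotsAbove a n) ≡ just s →
            a < s × s ≤ a + n × ¬ T (o s) × Occupied o (suc a) s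
    found {a} {zero} ()
    found {a} {suc n} {s} ff
      with T? (o (suc a)) | trans (cong (firstFree o) (sym (spotsAbove-suc a n))) ff
    ... | yes o1+a | ff′ =
      let 1+a<s , s≤1+a+n , free , run = found (trans (sym (firstFree-occupied o1+a)) ff′)
      in <⇒≤ 1+a<s , subst (s ≤_) (sym (+-suc a n)) s≤1+a+n , free
       , Occupied-join (Occupied-singleton o1+a) run
    ... | no free | ff′ with just-injective (trans (sym (firstFree-free {x = suc a} free)) ff′)
    ...   | refl =
      ≤-refl , subst (suc a ≤_) (sym (+-suc a n)) (s≤s (m≤m+n a n)) , free , Occupied-empty ≤-refl

    find : ∀ {a n s} → a < s × s ≤ a + n × ¬ T (o s) × Occupied o (suc a) s →
           firstFree o (spotsAbove a n) ≡ just s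
    find {a} {zero} {s} (a<s , s≤a+0 , _) =
      contradiction (subst (s ≤_) (+-identityʳ a) s≤a+0) (<⇒≱ a<s)
    find {a} {suc n} {s} (a<s , s≤a+1+n , free , run) =
      trans (cong (firstFree o) (spotsAbove-suc a n)) (step (m≤n⇒m<n∨m≡n a<s))
      where
      step : suc a < s ⊎ suc a ≡ s → firstFree o (suc a ∷ spotsAbove (suc a) n) ≡ just s
      step (inj₂ refl)  = firstFree-free free
      step (inj₁ 1+a<s) =
        trans (firstFree-occupied (run (suc a) ≤-refl 1+a<s))
              (find (1+a<s , subst (s ≤_) (+-suc a n) s≤a+1+n , free ,
                     Occupied-shrink (n≤1+n _) ≤-refl run))

  firstFree-backSpots≡just : ∀ {k a s} →
    firstFree o (backSpots k a) ≡ just s ⇔ (a ∸ k ≤ s × s < a × ¬ T (o s) × Occupied o (suc s) a)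
  firstFree-backSpots≡just {k} {a} rewrite backSpots≡spotsBelow k a | sym (m∸[n⊓m]≡m∸n a k) =
    firstFree-spotsBelow≡just (m⊓n≤n k a)

  firstFree-backSpots≡nothing : ∀ {k a} →
    firstFree o (backSpots k a) ≡ nothing ⇔ Occupied o (a ∸ k) a
  firstFree-backSpots≡nothing {k} {a} rewrite backSpots≡spotsBelow k a | sym (m∸[n⊓m]≡m∸n a k) =
    firstFree-spotsBelow≡nothing (m⊓n≤n k a)

  firstFree-fwdSpots≡just : ∀ {t ℓ a s} → firstFree o (fwdSpots t ℓ a) ≡ just s ⇔
    (a < s × s ≤ a + ℓ ⊓ (t ∸ a) × ¬ T (o s) × Occupied o (suc a) s)
  firstFree-fwdSpots≡just {t} {ℓ} {a} rewrite fwdSpots≡spotsAbove t ℓ a = firstFree-spotsAbove≡just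

count : (ℕ → Bool) → ℕ → ℕ
count P n = length (filterᵇ P (prefs n))

count-suc : ∀ P n → count P (suc n) ≡ count P n + length (filterᵇ P [ suc n ])
count-suc P n = begin
  length (filterᵇ P (prefs (suc n)))
    ≡⟨ cong (length ∘ filterᵇ P) (applyUpTo-∷ʳ suc n) ⟨
  length (filterᵇ P (prefs n ++ [ suc n ]))
    ≡⟨ cong length (filter-++ (T? ∘ P) (prefs n) [ suc n ]) ⟩
  length (filterᵇ P (prefs n) ++ filterᵇ P [ suc n ])
    ≡⟨ length-++ (filterᵇ P (prefs n)) ⟩
  count P n + length (filterᵇ P [ suc n ])
    ∎
  where open ≡-Reasoning

count-accept : ∀ P n → T (P (suc n)) → count P (suc n) ≡ suc (count P n)
count-accept P n p = trans (count-suc P n)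
  (trans (cong (_+_ (count P n) ∘ length) (filter-accept (T? ∘ P) p)) (+-comm _ 1))

count-reject : ∀ P n → ¬ T (P (suc n)) → count P (suc n) ≡ count P n
count-reject P n ¬p = trans (count-suc P n)
  (trans (cong (_+_ (count P n) ∘ length) (filter-reject (T? ∘ P) ¬p)) (+-identityʳ _))

count-interval : ∀ {P lo hi} → 1 ≤ lo → ∀ n →
  (∀ a → 1 ≤ a → a ≤ n → T (P a) ⇔ (lo ≤ a × a < hi)) → count P n ≡ (suc n ⊓ hi) ∸ lo
count-interval {hi = hi} 1≤lo zero _ = sym (m≤n⇒m∸n≡0 (≤-trans (m⊓n≤m 1 hi) 1≤lo))
count-interval {P} {lo} {hi} 1≤lo (suc n) member
  with IH ← count-interval 1≤lo n (λ a 1≤a a≤n → member a 1≤a (m≤n⇒m≤1+n a≤n))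
     | T? (P (suc n))
... | yes p = begin
  count P (suc n)            ≡⟨ count-accept P n p ⟩
  suc (count P n)            ≡⟨ cong suc IH ⟩
  suc ((suc n ⊓ hi) ∸ lo)    ≡⟨ cong (λ m → suc (m ∸ lo)) (m≤n⇒m⊓n≡m (<⇒≤ 1+n<hi)) ⟩
  suc (suc n ∸ lo)           ≡⟨ +-∸-assoc 1 lo≤1+n ⟨
  suc (suc n) ∸ lo           ≡⟨ cong (_∸ lo) (m≤n⇒m⊓n≡m 1+n<hi) ⟨
  (suc (suc n) ⊓ hi) ∸ lo    ∎
  where
  open ≡-Reasoning
  lo≤1+n = proj₁ (to (member (suc n) (s≤s z≤n) ≤-refl) p)
  1+n<hi = proj₂ (to (member (suc n) (s≤s z≤n) ≤-refl) p)
... | no ¬p = trans (count-reject P n ¬p) (trans IH outside)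
  where
  outside : (suc n ⊓ hi) ∸ lo ≡ (suc (suc n) ⊓ hi) ∸ lo
  outside with suc n <? hi
  ... | yes 1+n<hi = trans (m≤n⇒m∸n≡0 (≤-trans (m⊓n≤m (suc n) hi) (<⇒≤ 1+n<lo)))
                            (sym (m≤n⇒m∸n≡0 (≤-trans (m⊓n≤m (suc (suc n)) hi) 1+n<lo)))
    where
    1+n<lo : suc n < lo
    1+n<lo = ≰⇒> (λ lo≤1+n → ¬p (from (member (suc n) (s≤s z≤n) ≤-refl) (lo≤1+n , 1+n<hi)))
  ... | no 1+n≮hi = cong (_∸ lo) (trans (m≥n⇒m⊓n≡n hi≤1+n) (sym (m≥n⇒m⊓n≡n (m≤n⇒m≤1+n hi≤1+n))))
    where
    hi≤1+n = ≮⇒≥ 1+n≮hi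

module Street (t : ℕ) (π : ℕ → ℕ) (v : ℕ) where

  occupied⇒< : ∀ {y} → T (occ π v y) → π y < π v
  occupied⇒< {suc y} = <ᵇ⇒< (π (suc y)) (π v)

  occupied⇒positive : ∀ {y} → T (occ π v y) → 1 ≤ y
  occupied⇒positive {suc y} _ = s≤s z≤n

  <⇒occupied : ∀ {y} → 1 ≤ y → π y < π v → T (occ π v y)
  <⇒occupied {suc y} _ = <⇒<ᵇ

  v-free : ¬ T (occ π v v)
  v-free = <-irrefl refl ∘ occupied⇒<

  Right-occupied : ∀ {R} → IsRight t π v R → Occupied (occ π v) (suc v) (suc v + R)
  Right-occupied ((_ , smaller) , _) y v<y y<1+v+R =
    <⇒occupied (≤-trans (s≤s z≤n) v<y) (smaller y v<y (s≤s⁻¹ y<1+v+R))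

  Right-maximal : ∀ {R b} → IsRight t π v R → v ≤ b → b ≤ t →
                  Occupied (occ π v) (suc v) (suc b) → b ≤ v + R
  Right-maximal {R} {b} (_ , maximal) v≤b b≤t run =
    subst (_≤ v + R) v+[b∸v]≡b (+-monoʳ-≤ v (maximal (b ∸ v) (v+[b∸v]≤t , smaller)))
    where
    v+[b∸v]≡b : v + (b ∸ v) ≡ b
    v+[b∸v]≡b = m+[n∸m]≡n v≤b
    v+[b∸v]≤t : v + (b ∸ v) ≤ t
    v+[b∸v]≤t = subst (_≤ t) (sym v+[b∸v]≡b) b≤t
    smaller : ∀ y → suc v ≤ y → y ≤ v + (b ∸ v) → π y < π v
    smaller y v<y y≤ = occupied⇒< (run y v<y (s≤s (subst (y ≤_) v+[b∸v]≡b y≤)))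

  Left-occupied : ∀ {L} → IsLeft π v L → Occupied (occ π v) (v ∸ L) v
  Left-occupied ((L<v , smaller) , _) y v∸L≤y y<v =
    <⇒occupied (≤-trans (m<n⇒0<n∸m L<v) v∸L≤y) (proj₂ (smaller y v∸L≤y (∸-monoˡ-≤ 1 y<v)))

  Left-maximal : ∀ {L x} → (∀ u → 1 ≤ u → u ≤ t → 0 < π u) → v ≤ t → IsLeft π v L →
                 x < v → Occupied (occ π v) (v ∸ x) v → x ≤ L
  Left-maximal {x = x} positive v≤t (_ , maximal) x<v run = maximal x (x<v , smaller)
    where
    smaller : ∀ z → v ∸ x ≤ z → z ≤ v ∸ 1 → (0 < π z) × (π z < π v)
    smaller z v∸x≤z z≤v∸1 =
      positive z (occupied⇒positive oz) (≤-trans (<⇒≤ z<v) v≤t) , occupied⇒< oz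
      where
      z<v : z < v
      z<v = subst (suc z ≤_) (m+[n∸m]≡n (≤-trans (s≤s z≤n) x<v)) (s≤s z≤v∸1)
      oz : T (occ π v z)
      oz = run z v∸x≤z z<v

  backsInto : ℕ → ℕ → Bool
  backsInto k a = occ π v a ∧ isJust≡ (firstFree (occ π v) (backSpots k a)) v

  forwardsInto : ℕ → ℕ → ℕ → Bool
  forwardsInto k ℓ a = occ π v a ∧ isNothing (firstFree (occ π v) (backSpots k a))
                                 ∧ isJust≡ (firstFree (occ π v) (fwdSpots t ℓ a)) v

  T-backsInto : ∀ k {a} → T (backsInto k a) ⇔
    (T (occ π v a) × a ∸ k ≤ v × v < a × ¬ T (occ π v v) × Occupied (occ π v) (suc v) a)
  T-backsInto k = (⇔-id _ ×-⇔ (firstFree-backSpots≡just {k = k} ⇔-∘ T-isJust≡ _ v)) ⇔-∘ T-∧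

  T-forwardsInto : ∀ k ℓ {a} → T (forwardsInto k ℓ a) ⇔
    (T (occ π v a) × Occupied (occ π v) (a ∸ k) a ×
     a < v × v ≤ a + ℓ ⊓ (t ∸ a) × ¬ T (occ π v v) × Occupied (occ π v) (suc a) v)
  T-forwardsInto k ℓ =
    (⇔-id _ ×-⇔ (firstFree-backSpots≡nothing {k = k} ⇔-∘ T-isNothing _)
           ×-⇔ (firstFree-fwdSpots≡just {t = t} ⇔-∘ T-isJust≡ _ v))
    ⇔-∘ ((⇔-id _ ×-⇔ T-∧) ⇔-∘ T-∧)

  backsInto⇔ : ∀ k {R a} → IsRight t π v R → a ≤ t →
               T (backsInto k a) ⇔ (v < a × a < suc v + R ⊓ k)
  backsInto⇔ k {R} {a} isR a≤t = mk⇔ (interval ∘ to (T-backsInto k)) (from (T-backsInto k) ∘ backs)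
    where
    interval : T (occ π v a) × a ∸ k ≤ v × v < a × ¬ T (occ π v v) × Occupied (occ π v) (suc v) a →
               v < a × a < suc v + R ⊓ k
    interval (oa , a∸k≤v , v<a , _ , run) =
      v<a , s≤s (subst (a ≤_) (sym (+-distribˡ-⊓ v R k)) (⊓-glb a≤v+R a≤v+k))
      where
      a≤v+R = Right-maximal isR (<⇒≤ v<a) a≤t (Occupied-join run (Occupied-singleton oa))
      a≤v+k = subst (a ≤_) (+-comm k v) (m∸n≤o⇒m≤n+o a k a∸k≤v)

    backs : v < a × a < suc v + R ⊓ k →
            T (occ π v a) × a ∸ k ≤ v × v < a × ¬ T (occ π v v) × Occupied (occ π v) (suc v) a
    backs (v<a , a<) =
      Right-occupied isR a v<a (s≤s a≤v+R) ,
      m≤n+o⇒m∸n≤o a k (subst (a ≤_) (+-comm v k) a≤v+k) , v<a , v-free ,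
      Occupied-shrink ≤-refl (m≤n⇒m≤1+n a≤v+R) (Right-occupied isR)
      where
      a≤v+R = ≤-trans (s≤s⁻¹ a<) (+-monoʳ-≤ v (m⊓n≤m R k))
      a≤v+k = ≤-trans (s≤s⁻¹ a<) (+-monoʳ-≤ v (m⊓n≤n R k))

  forwardsInto⇔ : ∀ k ℓ {L a} → (∀ u → 1 ≤ u → u ≤ t → 0 < π u) → v ≤ t → IsLeft π v L →
                  T (forwardsInto k ℓ a) ⇔ (v ∸ ((L ∸ k) ⊓ ℓ) ≤ a × a < v)
  forwardsInto⇔ k ℓ {L} {a} positive v≤t isL =
    mk⇔ (interval ∘ to (T-forwardsInto k ℓ)) (from (T-forwardsInto k ℓ) ∘ forwards)
    where
    interval : T (occ π v a) × Occupied (occ π v) (a ∸ k) a ×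
               a < v × v ≤ a + ℓ ⊓ (t ∸ a) × ¬ T (occ π v v) × Occupied (occ π v) (suc a) v →
               v ∸ ((L ∸ k) ⊓ ℓ) ≤ a × a < v
    interval (oa , below , a<v , v≤a+ℓ⊓[t∸a] , _ , between) =
      m∸n≤o⇒m∸o≤n v a (⊓-glb v∸a≤L∸k v∸a≤ℓ) , a<v
      where
      -- spot 0 is free, so the occupied run below a cannot reach it
      k<a : k < a
      k<a = m∸n≢0⇒n<m (λ a∸k≡0 → below 0 (≤-reflexive a∸k≡0) (occupied⇒positive oa))
      run : Occupied (occ π v) (a ∸ k) v
      run = Occupied-join (Occupied-join below (Occupied-singleton oa)) between
      v∸a+k≤L : (v ∸ a) + k ≤ L
      v∸a+k≤L = Left-maximal positive v≤t isL
        (subst ((v ∸ a) + k <_) (m∸n+n≡m (<⇒≤ a<v)) (+-monoʳ-< (v ∸ a) k<a))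
        (subst (λ i → Occupied (occ π v) i v) (sym (m∸[[m∸n]+o]≡n∸o k (<⇒≤ a<v))) run)
      v∸a≤L∸k = m+n≤o⇒m≤o∸n (v ∸ a) v∸a+k≤L
      v∸a≤ℓ = m≤n+o⇒m∸n≤o v a (≤-trans v≤a+ℓ⊓[t∸a] (+-monoʳ-≤ a (m⊓n≤m ℓ (t ∸ a))))

    forwards : v ∸ ((L ∸ k) ⊓ ℓ) ≤ a × a < v →
               T (occ π v a) × Occupied (occ π v) (a ∸ k) a ×
               a < v × v ≤ a + ℓ ⊓ (t ∸ a) × ¬ T (occ π v v) × Occupied (occ π v) (suc a) v
    forwards (lo≤a , a<v) =
      run a (m∸n≤m a k) a<v , Occupied-shrink ≤-refl (<⇒≤ a<v) run ,
      a<v , v≤a+ℓ⊓[t∸a] , v-free , Occupied-shrink (≤-trans (m∸n≤m a k) (n≤1+n a)) ≤-refl run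
      where
      v∸a≤m = m∸n≤o⇒m∸o≤n v ((L ∸ k) ⊓ ℓ) lo≤a
      v∸a≤L∸k = ≤-trans v∸a≤m (m⊓n≤m (L ∸ k) ℓ)
      k<L = m∸n≢0⇒n<m (λ L∸k≡0 → <⇒≱ (m<n⇒0<n∸m a<v) (subst (v ∸ a ≤_) L∸k≡0 v∸a≤L∸k))
      v∸L≤a∸k = subst (v ∸ L ≤_) (m∸[[m∸n]+o]≡n∸o k (<⇒≤ a<v))
                  (∸-monoʳ-≤ v (m≤o∸n⇒m+n≤o (v ∸ a) (<⇒≤ k<L) v∸a≤L∸k))
      run : Occupied (occ π v) (a ∸ k) v
      run = Occupied-shrink v∸L≤a∸k ≤-refl (Left-occupied isL)
      v≤a+ℓ = m∸n≤o⇒m≤n+o v a (≤-trans v∸a≤m (m⊓n≤n (L ∸ k) ℓ))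
      v≤a+[t∸a] = subst (v ≤_) (sym (m+[n∸m]≡n (≤-trans (<⇒≤ a<v) v≤t))) v≤t
      v≤a+ℓ⊓[t∸a] = subst (v ≤_) (sym (+-distribˡ-⊓ a ℓ (t ∸ a))) (⊓-glb v≤a+ℓ v≤a+[t∸a])

corollary3p7 : (k ℓ t : ℕ) (π : ℕ → ℕ)
    → π 0 ≡ 0
    → (∀ u → 1 ≤ u → u ≤ t → 0 < π u)
    → (∀ u w → 1 ≤ u → u ≤ t → 1 ≤ w → w ≤ t → π u ≡ π w → u ≡ w)
    → (v : ℕ) → 1 ≤ v → v ≤ t
    → (R L : ℕ) → IsRight t π v R → IsLeft π v L
    → (Bcount k t π v ≡ R ⊓ k)
      × (+ (Fcount k ℓ t π v) ≡ ((+ L - + k) ⊓ℤ + ℓ) ⊔ + 0)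
corollary3p7 k ℓ t π _ positive _ v _ v≤t R L isR isL =
  B≡R⊓k , trans (cong +_ F≡m) (+[m∸n⊓o]≡[+m-+n]⊓+o⊔0 L k ℓ)
  where
  open Street t π v
  open ≡-Reasoning

  B≡R⊓k : Bcount k t π v ≡ R ⊓ k
  B≡R⊓k = begin
    count (backsInto k) t              ≡⟨ count-interval (s≤s z≤n) t (λ a _ → backsInto⇔ k isR) ⟩
    (suc t ⊓ (suc v + R ⊓ k)) ∸ suc v  ≡⟨ cong (_∸ suc v) (m≥n⇒m⊓n≡n (s≤s v+R⊓k≤t)) ⟩
    suc v + R ⊓ k ∸ suc v              ≡⟨ m+n∸m≡n (suc v) (R ⊓ k) ⟩
    R ⊓ k                              ∎
    where
    v+R⊓k≤t = ≤-trans (+-monoʳ-≤ v (m⊓n≤m R k)) (proj₁ (proj₁ isR))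

  m = (L ∸ k) ⊓ ℓ

  F≡m : Fcount k ℓ t π v ≡ m
  F≡m = begin
    count (forwardsInto k ℓ) t  ≡⟨ count-interval (m<n⇒0<n∸m m<v) t
                                     (λ _ _ _ → forwardsInto⇔ k ℓ positive v≤t isL) ⟩
    (suc t ⊓ v) ∸ (v ∸ m)       ≡⟨ cong (_∸ (v ∸ m)) (m≥n⇒m⊓n≡n (m≤n⇒m≤1+n v≤t)) ⟩
    v ∸ (v ∸ m)                 ≡⟨ m∸[m∸n]≡n (<⇒≤ m<v) ⟩
    m                           ∎
    where
    m<v = ≤-<-trans (≤-trans (m⊓n≤m (L ∸ k) ℓ) (m∸n≤m L k)) (proj₁ (proj₁ isL))
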